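{- Let $h,t\ge1$ be integers such that it is not the case that $h$ is even and $t$ is odd. Then $$S(h,t,2t_2)=\begin{cases}-S(h,t,1)/3&\text{if } \mathrm{lcm}(2,h_2)\mid t_2,\\ -S(h,t,1)&\text{if } \mathrm{lcm}(2,h_2)\nmid t_2.\end{cases}$$
   Context: $S(h,t,m)=\sum_{n\ge1,\ m\mid nt}\frac{\mu(n)(nt,h)}{nt\varphi(nt)}$, where $\mu$ is the Möbius function, $\varphi$ Euler's totient function and $(a,b)$ the gcd. For a positive integer $a$, $a_2$ denotes the largest power of $2$ dividing $a$. -}

module Defs where

open import Data.Nat as ℕ using (ℕ; zero; suc; _≤_; _≥_)
open import Data.Nat.GCD using (gcd)
open import Data.Nat.Divisibility using (_∣_; _∣?_)
open import Data.Nat.Primality using (prime?)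
open import Data.Nat.DivMod using (_/_; _%_)
open import Data.Integer as ℤ using (ℤ; +_)
open import Data.Rational as ℚ using (ℚ; 0ℚ; _+_; _-_; _<_; ∣_∣)
open import Data.List using (List; []; _∷_; length; filter; upTo; map; sum)
open import Data.Bool.ListAction using (any)
open import Data.Bool using (Bool; true; false; if_then_else_)
open import Relation.Nullary.Decidable using (does; _×-dec_; ⌊_⌋)
open import Relation.Nullary.Decidable using (Dec; yes; no)
open import Data.Product using (Σ; _×_)

range1 : ℕ → List ℕ
range1 n = map suc (upTo n)

φ : ℕ → ℕ
φ n = length (filter (λ k → gcd k n ℕ.≟ 1) (range1 n))

hasSquareFactor : ℕ → Bool
hasSquareFactor n = any (λ d → does ((suc (suc d) ℕ.* suc (suc d)) ∣? n)) (upTo n)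

ω : ℕ → ℕ
ω n = length (filter (λ p → prime? p ×-dec (p ∣? n)) (range1 n))

μ : ℕ → ℤ
μ zero = + 0
μ n@(suc _) = if hasSquareFactor n then + 0 else (ℤ.-1ℤ ℤ.^ ω n)

-- largest power of 2 dividing a (for a ≥ 1); a_2 in the paper
twoPartAux : ℕ → ℕ → ℕ
twoPartAux zero a = 1
twoPartAux (suc f) zero = 1
twoPartAux (suc f) a@(suc _) with a % 2 ℕ.≟ 0
... | yes _ = 2 ℕ.* twoPartAux f (a / 2)
... | no  _ = 1

_₂ : ℕ → ℕ
a ₂ = twoPartAux a a

-- a / d as a rational; the d = 0 case never occurs below
frac : ℤ → ℕ → ℚ
frac a zero = 0ℚ
frac a (suc d) = a ℚ./ suc d

-- the summand of S(h,t,m) at n, with the side condition m ∣ n t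
term : ℕ → ℕ → ℕ → ℕ → ℚ
term h t m n =
  if does (m ∣? (n ℕ.* t))
  then frac (μ n ℤ.* (+ gcd (n ℕ.* t) h)) ((n ℕ.* t) ℕ.* φ (n ℕ.* t))
  else 0ℚ

Spart : ℕ → ℕ → ℕ → ℕ → ℚ
Spart h t m N = Data.List.foldr _+_ 0ℚ (map (term h t m) (range1 N))
  where import Data.List

_≈lim_ : (ℕ → ℚ) → (ℕ → ℚ) → Set
f ≈lim g = ∀ (ε : ℚ) → 0ℚ < ε →
  Σ ℕ (λ N₀ → ∀ N → N ≥ N₀ → ∣ f N - g N ∣ < ε)

{-# OPTIONS --safe #-}
module Submission where

-- Split the summands V(n) = μ(n)(nt,h)/(ntφ(nt)) of S(h,t,1) = O + E into odd and even n.
-- As t = t₂·(odd), the condition 2t₂ ∣ nt says that n is even, so S(h,t,2t₂) = E.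
-- Multiples of 4 do not contribute since μ vanishes there, and for odd k one has μ(2k) = −μ(k),
-- (2kt,h) = r(kt,h) and φ(2kt) = sφ(kt), so V(2k) = aV(k) with a = −r/(2s). If lcm(2,h₂) ∣ t₂
-- then t is even and h₂ ∣ t, so r = 1, s = 2, a = −1/4; otherwise h and t are both odd
-- (r = s = 1) or t₂ < h₂ (r = s = 2), and a = −1/2.
-- On partial sums E_N = aO_⌊N/2⌋, hence E_N + c(O_N + E_N) = c(O_N − O_⌊N/2⌋) whenever
-- a(1 + c) = −c, that is for c = 1/3 resp. c = 1. Finally O_N − O_⌊N/2⌋ → 0: for odd n ≥ 2^(j+1)
-- the numbers u − 2, u − 4, …, u − 2^j, with u ≥ n the odd part of nt, are coprime to nt, so
-- φ(nt) ≥ j, and each of the at most ⌊N/2⌋ + 1 odd terms beyond ⌊N/2⌋ is at most h/(⌊N/2⌋ j).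

open import Defs
open import Algebra.Bundles using (CommutativeMonoid)
open import Data.Bool using (Bool; true; false; T; if_then_else_)
open import Data.Bool.Properties using (T-≡; ⇔→≡)
open import Data.Empty using (⊥-elim)
open import Data.Integer as ℤ using (ℤ; +_; +[1+_]; -[1+_])
import Data.Integer.Properties as ℤ
open import Data.Integer.Solver using () renaming (module +-*-Solver to ℤ-Solver)
open import Data.List using ([]; _∷_; _∷ʳ_; _++_; foldr; map; upTo; length; filter)
import Data.List.Properties as List
open import Data.List.Membership.Propositional using (find; lose)
open import Data.List.Membership.Propositional.Properties using (∈-upTo⁺)
open import Data.List.Relation.Unary.Any.Properties using (any⁺; any⁻)
open import Data.Nat as ℕ using (ℕ; zero; suc; _≤_; _<_; _+_; _*_; _∸_; _^_; z≤n; s≤s; NonZero; ⌊_/2⌋; ⌈_/2⌉)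
import Data.Nat.Properties as ℕ
open import Data.Nat.Coprimality using (Coprime; coprime?; coprime-divisor; coprime-+; coprime⇒gcd≡1; gcd≡1⇒coprime)
open import Data.Nat.Divisibility
open import Data.Nat.DivMod using (_%_; m*n/n≡m) renaming (_/_ to _/ℕ_)
open import Data.Nat.GCD using (gcd; gcd-greatest; gcd[m,n]∣m; gcd[m,n]∣n; gcd[m,n]≢0; gcd[m,n]≤n; c*gcd[m,n]≡gcd[cm,cn])
open import Data.Nat.LCM using (lcm; m∣lcm[m,n]; n∣lcm[m,n]; lcm-least)
open import Data.Nat.Primality using (Prime; prime?; ¬prime[1]; prime[2]; irreducible[2]; euclidsLemma)
open import Data.Nat.Solver using () renaming (module +-*-Solver to ℕ-Solver)
open import Data.Product using (Σ; ∃-syntax; _×_; _,_; proj₁; proj₂)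
open import Data.Rational as ℚ using (ℚ; 0ℚ; 1ℚ; toℚᵘ; -_; _/_) renaming (_*_ to _*ℚ_)
import Data.Rational.Properties as ℚ
open import Data.Rational.Solver using () renaming (module +-*-Solver to ℚ-Solver)
open import Data.Rational.Unnormalised as ℚᵘ using (mkℚᵘ; *≡*; *≤*; *<*)
import Data.Rational.Unnormalised.Properties as ℚᵘ
open import Data.Sum using (_⊎_; inj₁; inj₂)
open import Function using (_∘_)
open import Function.Bundles using (mk⇔; Equivalence)
open import Relation.Nullary using (¬_; Dec; yes; no; does)
open import Relation.Nullary.Decidable using (dec-true; dec-false; decidable-stable; _×-dec_)
open import Relation.Unary using (Pred; Decidable)
open import Relation.Binary.PropositionalEquality as ≡ using (_≡_; cong; cong₂; subst; subst₂)

-- Finite sums over 1, …, N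

range1-suc : ∀ n → range1 (suc n) ≡ range1 n ∷ʳ suc n
range1-suc n = ≡.trans (cong (map suc) (≡.sym (List.upTo-∷ʳ n))) (List.map-++ suc (upTo n) (n ∷ []))

module Sum {c ℓ} (M : CommutativeMonoid c ℓ) where

  open CommutativeMonoid M
  open import Algebra.Properties.CommutativeSemigroup commutativeSemigroup using (interchange)
  open import Relation.Binary.Reasoning.Setoid setoid

  ∑ : (ℕ → Carrier) → ℕ → Carrier
  ∑ f zero    = ε
  ∑ f (suc n) = ∑ f n ∙ f (suc n)

  ∑-cong : ∀ {f g} N → (∀ x → 1 ≤ x → x ≤ N → f x ≈ g x) → ∑ f N ≈ ∑ g N
  ∑-cong zero    f≈g = refl
  ∑-cong (suc N) f≈g =
    ∙-cong (∑-cong N (λ x 1≤x x≤N → f≈g x 1≤x (ℕ.m≤n⇒m≤1+n x≤N))) (f≈g (suc N) (s≤s z≤n) ℕ.≤-refl)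

  ∑-vanish : ∀ {f} N → (∀ x → 1 ≤ x → x ≤ N → f x ≈ ε) → ∑ f N ≈ ε
  ∑-vanish N f≈ε = trans (∑-cong N f≈ε) (∑-ε N)
    where
    ∑-ε : ∀ N → ∑ (λ _ → ε) N ≈ ε
    ∑-ε zero    = refl
    ∑-ε (suc N) = trans (identityʳ _) (∑-ε N)

  ∑-∙ : ∀ f g N → ∑ (λ x → f x ∙ g x) N ≈ ∑ f N ∙ ∑ g N
  ∑-∙ f g zero    = sym (identityˡ ε)
  ∑-∙ f g (suc N) = begin
    ∑ (λ x → f x ∙ g x) N ∙ (f (suc N) ∙ g (suc N)) ≈⟨ ∙-congʳ (∑-∙ f g N) ⟩
    (∑ f N ∙ ∑ g N) ∙ (f (suc N) ∙ g (suc N))        ≈⟨ interchange _ _ _ _ ⟩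
    ∑ f (suc N) ∙ ∑ g (suc N)                        ∎

  ∑-+ : ∀ f a b → ∑ f (a + b) ≈ ∑ f a ∙ ∑ (λ x → f (a + x)) b
  ∑-+ f a zero    = begin
    ∑ f (a + 0)  ≡⟨ cong (∑ f) (ℕ.+-identityʳ a) ⟩
    ∑ f a        ≈⟨ identityʳ (∑ f a) ⟨
    ∑ f a ∙ ε    ∎
  ∑-+ f a (suc b) = begin
    ∑ f (a + suc b)
      ≡⟨ cong (∑ f) (ℕ.+-suc a b) ⟩
    ∑ f (a + b) ∙ f (suc (a + b))
      ≈⟨ ∙-congʳ (∑-+ f a b) ⟩
    (∑ f a ∙ ∑ (λ x → f (a + x)) b) ∙ f (suc (a + b))
      ≡⟨ cong (λ n → (∑ f a ∙ ∑ (λ x → f (a + x)) b) ∙ f n) (ℕ.+-suc a b) ⟨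
    (∑ f a ∙ ∑ (λ x → f (a + x)) b) ∙ f (a + suc b)
      ≈⟨ assoc _ _ _ ⟩
    ∑ f a ∙ ∑ (λ x → f (a + x)) (suc b)
      ∎

  foldr-∷ʳ : ∀ xs y → foldr _∙_ ε (xs ∷ʳ y) ≈ foldr _∙_ ε xs ∙ y
  foldr-∷ʳ []       y = trans (identityʳ y) (sym (identityˡ y))
  foldr-∷ʳ (x ∷ xs) y = trans (∙-congˡ (foldr-∷ʳ xs y)) (sym (assoc x _ y))

  foldr-range1 : ∀ f N → foldr _∙_ ε (map f (range1 N)) ≈ ∑ f N
  foldr-range1 f zero    = refl
  foldr-range1 f (suc N) = begin
    foldr _∙_ ε (map f (range1 (suc N)))
      ≡⟨ cong (λ xs → foldr _∙_ ε (map f xs)) (range1-suc N) ⟩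
    foldr _∙_ ε (map f (range1 N ∷ʳ suc N))
      ≡⟨ cong (foldr _∙_ ε) (List.map-++ f (range1 N) (suc N ∷ [])) ⟩
    foldr _∙_ ε (map f (range1 N) ∷ʳ f (suc N))
      ≈⟨ foldr-∷ʳ (map f (range1 N)) (f (suc N)) ⟩
    foldr _∙_ ε (map f (range1 N)) ∙ f (suc N)
      ≈⟨ ∙-congʳ (foldr-range1 f N) ⟩
    ∑ f (suc N)
      ∎

module ℕΣ = Sum ℕ.+-0-commutativeMonoid
module ℚΣ = Sum ℚ.+-0-commutativeMonoid
open ℕΣ using (∑; ∑-cong; ∑-+; ∑-∙)

indicator : ∀ {a} {A : Set a} → Dec A → ℕ
indicator d = if does d then 1 else 0

indicator-yes : ∀ {a} {A : Set a} (d : Dec A) → A → indicator d ≡ 1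
indicator-yes (yes _) _ = ≡.refl
indicator-yes (no ¬a) a = ⊥-elim (¬a a)

indicator-no : ∀ {a} {A : Set a} (d : Dec A) → ¬ A → indicator d ≡ 0
indicator-no (no _)  _  = ≡.refl
indicator-no (yes a) ¬a = ⊥-elim (¬a a)

indicator-⊎ : ∀ {a b c} {A : Set a} {B : Set b} {C : Set c} (d : Dec A) (e : Dec B) (f : Dec C) →
              (A → B ⊎ C) → (B → A) → (C → A) → (B → ¬ C) → indicator d ≡ indicator e + indicator f
indicator-⊎ (yes a) e f to fromB fromC disjoint with to a
... | inj₁ b = ≡.sym (cong₂ _+_ (indicator-yes e b) (indicator-no f (disjoint b)))
... | inj₂ c = ≡.sym (cong₂ _+_ (indicator-no e (λ b → disjoint b c)) (indicator-yes f c))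
indicator-⊎ (no ¬a) e f to fromB fromC disjoint =
  ≡.sym (cong₂ _+_ (indicator-no e (¬a ∘ fromB)) (indicator-no f (¬a ∘ fromC)))

does-cong : ∀ {a b} {A : Set a} {B : Set b} (d : Dec A) (e : Dec B) → (A → B) → (B → A) → does d ≡ does e
does-cong (yes a) (yes b) f g = ≡.refl
does-cong (no ¬a) (no ¬b) f g = ≡.refl
does-cong (yes a) (no ¬b) f g = ⊥-elim (¬b (f a))
does-cong (no ¬a) (yes b) f g = ⊥-elim (¬a (g b))

indicator-cong : ∀ {a b} {A : Set a} {B : Set b} (d : Dec A) (e : Dec B) →
                 (A → B) → (B → A) → indicator d ≡ indicator e
indicator-cong d e f g = cong (λ b → if b then 1 else 0) (does-cong d e f g)

T-ext : ∀ {a b} → (T a → T b) → (T b → T a) → a ≡ b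
T-ext f g = ⇔→≡ {z = true} (mk⇔ (to T-≡ ∘ f ∘ from T-≡) (to T-≡ ∘ g ∘ from T-≡))
  where open Equivalence

T-does⁻ : ∀ {a} {A : Set a} (a? : Dec A) → T (does a?) → A
T-does⁻ (yes a) _ = a

T-does⁺ : ∀ {a} {A : Set a} (a? : Dec A) → A → T (does a?)
T-does⁺ (yes _) _ = _
T-does⁺ (no ¬a) a = ¬a a

length-filter-singleton : ∀ {p} {P : Pred ℕ p} (P? : Decidable P) x → length (filter P? (x ∷ [])) ≡ indicator (P? x)
length-filter-singleton P? x with P? x
... | yes _ = ≡.refl
... | no _  = ≡.refl

count : ∀ {p} {P : Pred ℕ p} → Decidable P → ℕ → ℕ
count P? = ∑ (λ x → indicator (P? x))

length-filter-range1 : ∀ {p} {P : Pred ℕ p} (P? : Decidable P) N →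
                       length (filter P? (range1 N)) ≡ count P? N
length-filter-range1 P? zero    = ≡.refl
length-filter-range1 P? (suc N) = begin
  length (filter P? (range1 (suc N)))
    ≡⟨ cong (λ xs → length (filter P? xs)) (range1-suc N) ⟩
  length (filter P? (range1 N ∷ʳ suc N))
    ≡⟨ cong length (List.filter-++ P? (range1 N) (suc N ∷ [])) ⟩
  length (filter P? (range1 N) ++ filter P? (suc N ∷ []))
    ≡⟨ List.length-++ (filter P? (range1 N)) ⟩
  length (filter P? (range1 N)) + length (filter P? (suc N ∷ []))
    ≡⟨ cong (_+_ (length (filter P? (range1 N)))) (length-filter-singleton P? (suc N)) ⟩
  length (filter P? (range1 N)) + indicator (P? (suc N))
    ≡⟨ cong (_+ indicator (P? (suc N))) (length-filter-range1 P? N) ⟩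
  count P? (suc N)
    ∎
  where open ≡.≡-Reasoning

term≤∑ : ∀ f {x} b → 1 ≤ x → x ≤ b → f x ≤ ∑ f b
term≤∑ f zero    1≤x x≤0 = ⊥-elim (ℕ.<-irrefl ≡.refl (ℕ.≤-trans 1≤x x≤0))
term≤∑ f (suc b) 1≤x x≤b with ℕ.m≤n⇒m<n∨m≡n x≤b
... | inj₂ ≡.refl = ℕ.m≤n+m (f (suc b)) (∑ f b)
... | inj₁ x<1+b  = ℕ.≤-trans (term≤∑ f b 1≤x (ℕ.≤-pred x<1+b)) (ℕ.m≤m+n (∑ f b) _)

∑-split : ∀ f {a b} → a ≤ b → ∑ f b ≡ ∑ f a + ∑ (λ x → f (a + x)) (b ∸ a)
∑-split f {a} a≤b = ≡.trans (cong (∑ f) (≡.sym (ℕ.m+[n∸m]≡n a≤b))) (∑-+ f a _)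

∑-mono : ∀ f {a b} → a ≤ b → ∑ f a ≤ ∑ f b
∑-mono f a≤b = subst (_ ≤_) (≡.sym (∑-split f a≤b)) (ℕ.m≤m+n _ _)

∑+term≤∑ : ∀ f {a b x} → a < x → x ≤ b → ∑ f a + f x ≤ ∑ f b
∑+term≤∑ f {a} {b} {x} a<x x≤b = subst (∑ f a + f x ≤_) (≡.sym (∑-split f (ℕ.≤-trans (ℕ.<⇒≤ a<x) x≤b)))
  (ℕ.+-monoʳ-≤ (∑ f a) (subst (_≤ ∑ (λ y → f (a + y)) (b ∸ a)) (cong f (ℕ.m+[n∸m]≡n (ℕ.<⇒≤ a<x)))
    (term≤∑ (λ y → f (a + y)) (b ∸ a) (ℕ.m<n⇒0<n∸m a<x) (ℕ.∸-monoˡ-≤ a x≤b))))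

-- Parity and coprimality

Odd : ℕ → Set
Odd n = ¬ (2 ∣ n)

odd-1 : Odd 1
odd-1 2∣1 with ∣⇒≤ 2∣1
... | s≤s ()

odd⇒≥1 : ∀ {n} → Odd n → 1 ≤ n
odd⇒≥1 {zero}  odd = ⊥-elim (odd (divides 0 ≡.refl))
odd⇒≥1 {suc n} _   = s≤s z≤n

2∣n⊎2∣1+n : ∀ n → 2 ∣ n ⊎ 2 ∣ suc n
2∣n⊎2∣1+n zero    = inj₁ (divides 0 ≡.refl)
2∣n⊎2∣1+n (suc n) with 2∣n⊎2∣1+n n
... | inj₁ 2∣n   = inj₂ (∣m∣n⇒∣m+n (∣-refl {2}) 2∣n)
... | inj₂ 2∣1+n = inj₁ 2∣1+n

odd+odd : ∀ {m n} → Odd m → Odd n → 2 ∣ m + n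
odd+odd {m} {n} odd-m odd-n = ∣m+n∣m⇒∣n (subst (2 ∣_) 2+[m+n]≡ (∣m∣n⇒∣m+n (even-suc odd-m) (even-suc odd-n))) (∣-refl {2})
  where
  even-suc : ∀ {k} → Odd k → 2 ∣ suc k
  even-suc {k} odd-k with 2∣n⊎2∣1+n k
  ... | inj₁ 2∣k   = ⊥-elim (odd-k 2∣k)
  ... | inj₂ 2∣1+k = 2∣1+k
  2+[m+n]≡ : suc m + suc n ≡ 2 + (m + n)
  2+[m+n]≡ = cong suc (ℕ.+-suc m n)

odd*odd : ∀ {m n} → Odd m → Odd n → Odd (m * n)
odd*odd {m} {n} odd-m odd-n 2∣mn with euclidsLemma m n prime[2] 2∣mn
... | inj₁ 2∣m = odd-m 2∣m
... | inj₂ 2∣n = odd-n 2∣n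

parity : ∀ n → n ≡ 2 * ⌊ n /2⌋ ⊎ n ≡ suc (2 * ⌊ n /2⌋)
parity zero          = inj₁ ≡.refl
parity (suc zero)    = inj₂ ≡.refl
parity (suc (suc n)) with parity n
... | inj₁ n≡2m   = inj₁ (≡.trans (cong (suc ∘ suc) n≡2m) (≡.sym (ℕ.*-suc 2 ⌊ n /2⌋)))
... | inj₂ n≡2m+1 = inj₂ (≡.trans (cong (suc ∘ suc) n≡2m+1) (cong suc (≡.sym (ℕ.*-suc 2 ⌊ n /2⌋))))

⌈n/2⌉≤1+⌊n/2⌋ : ∀ n → ⌈ n /2⌉ ≤ suc ⌊ n /2⌋
⌈n/2⌉≤1+⌊n/2⌋ zero          = z≤n
⌈n/2⌉≤1+⌊n/2⌋ (suc zero)    = s≤s z≤n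
⌈n/2⌉≤1+⌊n/2⌋ (suc (suc n)) = s≤s (⌈n/2⌉≤1+⌊n/2⌋ n)

odd-1+2* : ∀ m → Odd (suc (2 * m))
odd-1+2* m 2∣1+2m = odd-1 (∣m+n∣m⇒∣n (subst (2 ∣_) (ℕ.+-comm 1 (2 * m)) 2∣1+2m) (m∣m*n m))

odd⇒coprime-2 : ∀ {d} → Odd d → Coprime d 2
odd⇒coprime-2 odd-d (e∣d , e∣2) with irreducible[2] e∣2
... | inj₁ e≡1      = e≡1
... | inj₂ ≡.refl   = ⊥-elim (odd-d e∣d)

odd∣2^⇒≡1 : ∀ {d} i → Odd d → d ∣ 2 ^ i → d ≡ 1
odd∣2^⇒≡1 zero    odd-d d∣1   = ∣1⇒≡1 d∣1
odd∣2^⇒≡1 (suc i) odd-d d∣2^i = odd∣2^⇒≡1 i odd-d (coprime-divisor (odd⇒coprime-2 odd-d) d∣2^i)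

coprime-* : ∀ {a b c} → Coprime a b → Coprime a c → Coprime a (b * c)
coprime-* a⊥b a⊥c (d∣a , d∣bc) = a⊥c (d∣a , coprime-divisor (λ (e∣d , e∣b) → a⊥b (∣-trans e∣d d∣a , e∣b)) d∣bc)

coprime-2*⇒ : ∀ {x m} → Coprime x (2 * m) → Coprime x m
coprime-2*⇒ {m = m} x⊥2m (d∣x , d∣m) = x⊥2m (d∣x , ∣n⇒∣m*n 2 d∣m)

coprime-2*⇒odd : ∀ {x m} → Coprime x (2 * m) → Odd x
coprime-2*⇒odd {m = m} x⊥2m 2∣x with x⊥2m (2∣x , m∣m*n m)
... | ()

coprime-2*⇐ : ∀ {x m} → Odd x → Coprime x m → Coprime x (2 * m)
coprime-2*⇐ odd-x = coprime-* (odd⇒coprime-2 odd-x)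

coprime-even⇒odd : ∀ {x m} → 2 ∣ m → Coprime x m → Odd x
coprime-even⇒odd 2∣m x⊥m 2∣x with x⊥m (2∣x , 2∣m)
... | ()

coprime-+⇒ : ∀ {m x} → Coprime (m + x) m → Coprime x m
coprime-+⇒ m+x⊥m (d∣x , d∣m) = m+x⊥m (∣m∣n⇒∣m+n d∣m d∣x , d∣m)

gcd-2*-cases : ∀ x {h} → 1 ≤ h → gcd (2 * x) h ≡ gcd x h ⊎ gcd (2 * x) h ≡ 2 * gcd x h
gcd-2*-cases x {h} 1≤h = ratio (gcd-greatest (∣n⇒∣m*n 2 (gcd[m,n]∣m x h)) (gcd[m,n]∣n x h))
  where
  instance
    g≢0 : NonZero (gcd x h)
    g≢0 = ℕ.≢-nonZero (gcd[m,n]≢0 x h (inj₂ (ℕ.n>0⇒n≢0 1≤h)))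
  G∣2g : gcd (2 * x) h ∣ 2 * gcd x h
  G∣2g = subst (gcd (2 * x) h ∣_) (≡.sym (c*gcd[m,n]≡gcd[cm,cn] 2 x h))
           (gcd-greatest (gcd[m,n]∣m (2 * x) h) (∣n⇒∣m*n 2 (gcd[m,n]∣n (2 * x) h)))
  ratio : gcd x h ∣ gcd (2 * x) h → gcd (2 * x) h ≡ gcd x h ⊎ gcd (2 * x) h ≡ 2 * gcd x h
  ratio (divides e G≡e*g) with irreducible[2] {e} (*-cancelʳ-∣ (gcd x h) (subst (_∣ 2 * gcd x h) G≡e*g G∣2g))
  ... | inj₁ ≡.refl = inj₁ (≡.trans G≡e*g (ℕ.*-identityˡ (gcd x h)))
  ... | inj₂ ≡.refl = inj₂ G≡e*g

gcd-2*-≡ : ∀ {x h} p → 1 ≤ h → p ∣ x → p ∣ h → ¬ (p * 2 ∣ h) → gcd (2 * x) h ≡ gcd x h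
gcd-2*-≡ {x} {h} p 1≤h p∣x p∣h p*2∤h with gcd-2*-cases x 1≤h
... | inj₁ G≡g  = G≡g
... | inj₂ G≡2g = ⊥-elim (p*2∤h (∣-trans p*2∣G (gcd[m,n]∣n (2 * x) h)))
  where
  p*2∣G : p * 2 ∣ gcd (2 * x) h
  p*2∣G = subst (p * 2 ∣_) (≡.trans (ℕ.*-comm (gcd x h) 2) (≡.sym G≡2g)) (*-monoˡ-∣ 2 (gcd-greatest p∣x p∣h))

gcd-2*-double : ∀ {x h} q → 1 ≤ h → q ∣ x → q * 2 ∣ h → ¬ (q * 2 ∣ x) → gcd (2 * x) h ≡ 2 * gcd x h
gcd-2*-double {x} {h} q 1≤h q∣x q*2∣h q*2∤x with gcd-2*-cases x 1≤h
... | inj₂ G≡2g = G≡2g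
... | inj₁ G≡g  = ⊥-elim (q*2∤x (∣-trans (subst (q * 2 ∣_) G≡g (gcd-greatest q*2∣2x q*2∣h)) (gcd[m,n]∣m x h)))
  where
  q*2∣2x : q * 2 ∣ 2 * x
  q*2∣2x = subst (q * 2 ∣_) (ℕ.*-comm x 2) (*-monoˡ-∣ 2 q∣x)

-- Euler's totient function

2*≡+ : ∀ n → 2 * n ≡ n + n
2*≡+ n = cong (_+_ n) (ℕ.+-identityʳ n)

count-2* : ∀ {p} {P : Pred ℕ p} (P? : Decidable P) m →
           count P? (2 * m) ≡ count P? m + ∑ (λ x → indicator (P? (m + x))) m
count-2* P? m = ≡.trans (cong (count P?) (2*≡+ m)) (∑-+ _ m m)

coprimeTo? : ∀ n → Decidable (λ x → Coprime x n)
coprimeTo? n x = coprime? x n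

φ≡count : ∀ n → φ n ≡ count (coprimeTo? n) n
φ≡count n = ≡.trans (length-filter-range1 _ n)
  (∑-cong n (λ x _ _ → indicator-cong (gcd x n ℕ.≟ 1) (coprime? x n) gcd≡1⇒coprime coprime⇒gcd≡1))

φ-2*-even : ∀ {m} → 2 ∣ m → φ (2 * m) ≡ 2 * φ m
φ-2*-even {m} 2∣m = begin
  φ (2 * m)
    ≡⟨ φ≡count (2 * m) ⟩
  count (coprimeTo? (2 * m)) (2 * m)
    ≡⟨ ∑-cong (2 * m) (λ x _ _ → indicator-cong (coprime? x (2 * m)) (coprime? x m) coprime-2*⇒ 2*-coprime) ⟩
  count (coprimeTo? m) (2 * m)
    ≡⟨ count-2* (coprimeTo? m) m ⟩
  count (coprimeTo? m) m + ∑ (λ x → indicator (coprime? (m + x) m)) m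
    ≡⟨ cong (_+_ (count (coprimeTo? m) m)) (∑-cong m (λ x _ _ → shift x)) ⟩
  count (coprimeTo? m) m + count (coprimeTo? m) m
    ≡⟨ 2*≡+ (count (coprimeTo? m) m) ⟨
  2 * count (coprimeTo? m) m
    ≡⟨ cong (2 *_) (φ≡count m) ⟨
  2 * φ m
    ∎
  where
  open ≡.≡-Reasoning
  2*-coprime : ∀ {x} → Coprime x m → Coprime x (2 * m)
  2*-coprime x⊥m = coprime-2*⇐ (coprime-even⇒odd 2∣m x⊥m) x⊥m
  shift : ∀ x → indicator (coprime? (m + x) m) ≡ indicator (coprime? x m)
  shift x = indicator-cong (coprime? (m + x) m) (coprime? x m) coprime-+⇒ coprime-+

φ-2*-odd : ∀ {m} → Odd m → φ (2 * m) ≡ φ m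
φ-2*-odd {m} odd-m = begin
  φ (2 * m)
    ≡⟨ φ≡count (2 * m) ⟩
  count (coprimeTo? (2 * m)) (2 * m)
    ≡⟨ count-2* (coprimeTo? (2 * m)) m ⟩
  count (coprimeTo? (2 * m)) m + ∑ (λ x → [ m + x ⊥ 2 * m ]) m
    ≡⟨ ∑-∙ (λ x → [ x ⊥ 2 * m ]) (λ x → [ m + x ⊥ 2 * m ]) m ⟨
  ∑ (λ x → [ x ⊥ 2 * m ] + [ m + x ⊥ 2 * m ]) m
    ≡⟨ ∑-cong m (λ x _ _ → exactly-one x) ⟩
  count (coprimeTo? m) m
    ≡⟨ φ≡count m ⟨
  φ m
    ∎
  where
  open ≡.≡-Reasoning
  [_⊥_] : ℕ → ℕ → ℕ
  [ x ⊥ n ] = indicator (coprime? x n)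
  exactly-one : ∀ x → [ x ⊥ 2 * m ] + [ m + x ⊥ 2 * m ] ≡ [ x ⊥ m ]
  exactly-one x with 2 ∣? x
  ... | yes 2∣x = begin
    [ x ⊥ 2 * m ] + [ m + x ⊥ 2 * m ]
      ≡⟨ cong (_+ [ m + x ⊥ 2 * m ]) (indicator-no (coprime? x (2 * m)) (λ x⊥2m → coprime-2*⇒odd {x} {m} x⊥2m 2∣x)) ⟩
    [ m + x ⊥ 2 * m ]
      ≡⟨ indicator-cong (coprime? (m + x) (2 * m)) (coprime? x m)
                        (coprime-+⇒ ∘ coprime-2*⇒ {m + x} {m}) (coprime-2*⇐ odd-m+x ∘ coprime-+) ⟩
    [ x ⊥ m ]
      ∎
    where
    odd-m+x : Odd (m + x)
    odd-m+x 2∣m+x = odd-m (∣m+n∣m⇒∣n (subst (2 ∣_) (ℕ.+-comm m x) 2∣m+x) 2∣x)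
  ... | no odd-x = begin
    [ x ⊥ 2 * m ] + [ m + x ⊥ 2 * m ]
      ≡⟨ cong (_+_ [ x ⊥ 2 * m ]) (indicator-no (coprime? (m + x) (2 * m))
                                    (λ m+x⊥2m → coprime-2*⇒odd {m + x} {m} m+x⊥2m (odd+odd odd-m odd-x))) ⟩
    [ x ⊥ 2 * m ] + 0
      ≡⟨ ℕ.+-identityʳ [ x ⊥ 2 * m ] ⟩
    [ x ⊥ 2 * m ]
      ≡⟨ indicator-cong (coprime? x (2 * m)) (coprime? x m) (coprime-2*⇒ {x} {m}) (coprime-2*⇐ odd-x) ⟩
    [ x ⊥ m ]
      ∎

count-< : ∀ {p} {P : Pred ℕ p} (P? : Decidable P) {a b x} → a < x → x ≤ b → P x → count P? a < count P? b
count-< P? {a} {b} {x} a<x x≤b px = subst (_≤ count P? b) (ℕ.+-comm (count P? a) 1)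
  (subst (λ i → count P? a + i ≤ count P? b) (indicator-yes (P? x) px) (∑+term≤∑ _ a<x x≤b))

module _ {u : ℕ} (b : ℕ) (odd-u : Odd u) where

  u∸2^-coprime : ∀ i → 2 ^ suc i < u → Coprime (u ∸ 2 ^ suc i) (2 ^ b * u)
  u∸2^-coprime i 2^i<u = coprime-* y⊥2^b y⊥u
    where
    y = u ∸ 2 ^ suc i
    y+2^i≡u : y + 2 ^ suc i ≡ u
    y+2^i≡u = ℕ.m∸n+n≡m (ℕ.<⇒≤ 2^i<u)
    odd-y : Odd y
    odd-y 2∣y = odd-u (subst (2 ∣_) y+2^i≡u (∣m∣n⇒∣m+n 2∣y (∣m⇒∣m*n (2 ^ i) (∣-refl {2}))))
    y⊥2^b : Coprime y (2 ^ b)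
    y⊥2^b (d∣y , d∣2^b) = odd∣2^⇒≡1 b (λ 2∣d → odd-y (∣-trans 2∣d d∣y)) d∣2^b
    y⊥u : Coprime y u
    y⊥u (d∣y , d∣u) = odd∣2^⇒≡1 (suc i) (λ 2∣d → odd-u (∣-trans 2∣d d∣u))
                        (∣m+n∣m⇒∣n (subst (_ ∣_) (≡.sym y+2^i≡u) d∣u) d∣y)

  count-coprime-below : ∀ j → 2 ^ suc j ≤ u → count (coprimeTo? (2 ^ b * u)) (u ∸ 2 ^ suc j) + j ≤ count (coprimeTo? (2 ^ b * u)) u
  count-coprime-below zero    _         = ℕ.≤-trans (ℕ.≤-reflexive (ℕ.+-identityʳ _)) (∑-mono _ (ℕ.m∸n≤m u 2))
  count-coprime-below (suc j) 2^j+2≤u = begin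
    count P? z + suc j  ≡⟨ ℕ.+-suc (count P? z) j ⟩
    suc (count P? z) + j ≤⟨ ℕ.+-monoˡ-≤ j (count-< P? z<y ℕ.≤-refl (u∸2^-coprime j 2^j+1<u)) ⟩
    count P? y + j       ≤⟨ count-coprime-below j (ℕ.<⇒≤ 2^j+1<u) ⟩
    count P? u           ∎
    where
    open ℕ.≤-Reasoning
    P? = coprimeTo? (2 ^ b * u)
    y = u ∸ 2 ^ suc j
    z = u ∸ 2 ^ suc (suc j)
    2^j+1<2^j+2 : 2 ^ suc j < 2 ^ suc (suc j)
    2^j+1<2^j+2 = ℕ.^-monoʳ-< 2 (s≤s (s≤s z≤n)) (ℕ.n<1+n (suc j))
    2^j+1<u : 2 ^ suc j < u
    2^j+1<u = ℕ.<-≤-trans 2^j+1<2^j+2 2^j+2≤u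
    z<y : z < y
    z<y = ℕ.∸-monoʳ-< 2^j+1<2^j+2 2^j+2≤u

  φ-2^*odd-≥ : ∀ j → 2 ^ suc j ≤ u → j ≤ φ (2 ^ b * u)
  φ-2^*odd-≥ j 2^j+1≤u = begin
    j                                       ≤⟨ ℕ.m≤n+m j _ ⟩
    count P? (u ∸ 2 ^ suc j) + j            ≤⟨ count-coprime-below j 2^j+1≤u ⟩
    count P? u                              ≤⟨ ∑-mono _ (ℕ.m≤n*m u (2 ^ b) {{ℕ.m^n≢0 2 b}}) ⟩
    count P? (2 ^ b * u)                    ≡⟨ φ≡count (2 ^ b * u) ⟨
    φ (2 ^ b * u)                           ∎
    where
    open ℕ.≤-Reasoning
    P? = coprimeTo? (2 ^ b * u)

-- The 2-part of a number

record IsTwoPart (v a : ℕ) : Set where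
  constructor mkTwoPart
  field
    exponent     : ℕ
    cofactor     : ℕ
    v≡2^e        : v ≡ 2 ^ exponent
    a≡2^e*c      : a ≡ 2 ^ exponent * cofactor
    odd-cofactor : Odd cofactor

twoPartAux-isTwoPart : ∀ f a → 1 ≤ a → a ≤ f → IsTwoPart (twoPartAux f a) a
twoPartAux-isTwoPart (suc f) (suc a) _ 1+a≤1+f with suc a % 2 ℕ.≟ 0
... | no  a%2≢0 = mkTwoPart 0 (suc a) ≡.refl (≡.sym (ℕ.+-identityʳ (suc a))) (a%2≢0 ∘ n∣m⇒m%n≡0 (suc a) 2)
... | yes a%2≡0 with m%n≡0⇒n∣m (suc a) 2 a%2≡0
...   | divides q 1+a≡q*2 = double (twoPartAux-isTwoPart f (suc a /ℕ 2) 1≤a/2 a/2≤f)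
  where
  a/2≡q : suc a /ℕ 2 ≡ q
  a/2≡q = ≡.trans (cong (_/ℕ 2) 1+a≡q*2) (m*n/n≡m q 2)
  1≤q : 1 ≤ q
  1≤q = ℕ.n≢0⇒n>0 λ { ≡.refl → ℕ.1+n≢0 1+a≡q*2 }
  1≤a/2 : 1 ≤ suc a /ℕ 2
  1≤a/2 = subst (1 ≤_) (≡.sym a/2≡q) 1≤q
  a/2≤f : suc a /ℕ 2 ≤ f
  a/2≤f = subst (_≤ f) (≡.sym a/2≡q) (ℕ.≤-pred (ℕ.<-≤-trans q<1+a 1+a≤1+f))
    where
    q<1+a : q < suc a
    q<1+a = subst (q <_) (≡.sym 1+a≡q*2) (ℕ.m<m*n q 2 {{ℕ.>-nonZero 1≤q}} (s≤s (s≤s z≤n)))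
  double : IsTwoPart (twoPartAux f (suc a /ℕ 2)) (suc a /ℕ 2) → IsTwoPart (2 * twoPartAux f (suc a /ℕ 2)) (suc a)
  double (mkTwoPart e c v≡2^e a/2≡2^e*c odd-c) = mkTwoPart (suc e) c (cong (2 *_) v≡2^e) (begin
    suc a                 ≡⟨ 1+a≡q*2 ⟩
    q * 2                 ≡⟨ cong (_* 2) (≡.trans (≡.sym a/2≡q) a/2≡2^e*c) ⟩
    2 ^ e * c * 2         ≡⟨ ℕ.*-comm (2 ^ e * c) 2 ⟩
    2 * (2 ^ e * c)       ≡⟨ ℕ.*-assoc 2 (2 ^ e) c ⟨
    2 ^ suc e * c         ∎) odd-c
    where open ≡.≡-Reasoning

₂-isTwoPart : ∀ {a} → 1 ≤ a → IsTwoPart (a ₂) a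
₂-isTwoPart {a} 1≤a = twoPartAux-isTwoPart a a 1≤a ℕ.≤-refl

2^-mono-∣ : ∀ {m n} → m ≤ n → 2 ^ m ∣ 2 ^ n
2^-mono-∣ {m} {n} m≤n = divides (2 ^ (n ∸ m)) (begin
  2 ^ n                 ≡⟨ cong (2 ^_) (ℕ.m+[n∸m]≡n m≤n) ⟨
  2 ^ (m + (n ∸ m))     ≡⟨ ℕ.^-distribˡ-+-* 2 m (n ∸ m) ⟩
  2 ^ m * 2 ^ (n ∸ m)   ≡⟨ ℕ.*-comm (2 ^ m) (2 ^ (n ∸ m)) ⟩
  2 ^ (n ∸ m) * 2 ^ m   ∎)
  where open ≡.≡-Reasoning

2^∤⇒2^∣ : ∀ m n → ¬ (2 ^ m ∣ 2 ^ n) → 2 ^ n * 2 ∣ 2 ^ m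
2^∤⇒2^∣ m n 2^m∤2^n with m ℕ.≤? n
... | yes m≤n = ⊥-elim (2^m∤2^n (2^-mono-∣ m≤n))
... | no  m≰n = subst (_∣ 2 ^ m) (ℕ.*-comm 2 (2 ^ n)) (2^-mono-∣ (ℕ.≰⇒> m≰n))

module _ {a : ℕ} (1≤a : 1 ≤ a) where
  open IsTwoPart (₂-isTwoPart 1≤a)

  ₂∣ : a ₂ ∣ a
  ₂∣ = divides cofactor (≡.trans a≡2^e*c (≡.trans (ℕ.*-comm (2 ^ exponent) cofactor) (cong (cofactor *_) (≡.sym v≡2^e))))

  ₂*2∤odd* : ∀ {k} → Odd k → ¬ (a ₂ * 2 ∣ k * a)
  ₂*2∤odd* {k} odd-k ₂*2∣ka = odd*odd odd-k odd-cofactor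
    (*-cancelˡ-∣ (2 ^ exponent) {{ℕ.m^n≢0 2 exponent}} (subst₂ _∣_ (cong (_* 2) v≡2^e) ka≡ ₂*2∣ka))
    where
    ka≡ : k * a ≡ 2 ^ exponent * (k * cofactor)
    ka≡ = begin
      k * a                       ≡⟨ cong (k *_) a≡2^e*c ⟩
      k * (2 ^ exponent * cofactor) ≡⟨ ℕ.*-assoc k (2 ^ exponent) cofactor ⟨
      k * 2 ^ exponent * cofactor ≡⟨ cong (_* cofactor) (ℕ.*-comm k (2 ^ exponent)) ⟩
      2 ^ exponent * k * cofactor ≡⟨ ℕ.*-assoc (2 ^ exponent) k cofactor ⟩
      2 ^ exponent * (k * cofactor) ∎
      where open ≡.≡-Reasoning

  2∣⇒2∣₂ : 2 ∣ a → 2 ∣ a ₂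
  2∣⇒2∣₂ 2∣a with exponent | v≡2^e | a≡2^e*c
  ... | zero    | _      | a≡c = ⊥-elim (odd-cofactor (subst (2 ∣_) (≡.trans a≡c (ℕ.*-identityˡ cofactor)) 2∣a))
  ... | suc e   | v≡2^e+1 | _  = subst (2 ∣_) (≡.sym v≡2^e+1) (m∣m*n (2 ^ e))

₂∤⇒₂*2∣ : ∀ {a b} → 1 ≤ a → 1 ≤ b → ¬ (a ₂ ∣ b ₂) → b ₂ * 2 ∣ a ₂
₂∤⇒₂*2∣ 1≤a 1≤b ∤ with ₂-isTwoPart 1≤a | ₂-isTwoPart 1≤b
... | mkTwoPart i _ a₂≡2^i _ _ | mkTwoPart j _ b₂≡2^j _ _ =
  subst₂ (λ u v → u * 2 ∣ v) (≡.sym b₂≡2^j) (≡.sym a₂≡2^i) (2^∤⇒2^∣ i j (subst₂ (λ u v → ¬ (u ∣ v)) a₂≡2^i b₂≡2^j ∤))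

-- The Möbius function

HasSquareFactor : ℕ → Set
HasSquareFactor n = ∃[ d ] 2 ≤ d × d * d ∣ n

squareDivides : ℕ → ℕ → Bool
squareDivides n d = does (suc (suc d) * suc (suc d) ∣? n)

hasSquareFactor-sound : ∀ {n} → T (hasSquareFactor n) → HasSquareFactor n
hasSquareFactor-sound {n} t with find (any⁻ (squareDivides n) (upTo n) t)
... | d , _ , dd∣n = suc (suc d) , s≤s (s≤s z≤n) , T-does⁻ (suc (suc d) * suc (suc d) ∣? n) dd∣n

hasSquareFactor-complete : ∀ {n} → 1 ≤ n → HasSquareFactor n → T (hasSquareFactor n)
hasSquareFactor-complete {n} 1≤n (suc zero , s≤s () , _)
hasSquareFactor-complete {n} 1≤n (suc (suc d) , _ , dd∣n) = any⁺ (squareDivides n) (lose (∈-upTo⁺ d<n) (T-does⁺ (suc (suc d) * suc (suc d) ∣? n) dd∣n))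
  where
  d<n : d < n
  d<n = ℕ.≤-trans (ℕ.≤-trans (ℕ.n≤1+n (suc d)) (ℕ.m≤m*n (suc (suc d)) (suc (suc d))))
                  (∣⇒≤ {{ℕ.>-nonZero 1≤n}} dd∣n)

hasSquareFactor-2*odd : ∀ {k} → 1 ≤ k → Odd k → hasSquareFactor (2 * k) ≡ hasSquareFactor k
hasSquareFactor-2*odd {k} 1≤k odd-k = T-ext
  (hasSquareFactor-complete 1≤k ∘ halve ∘ hasSquareFactor-sound)
  (hasSquareFactor-complete (ℕ.≤-trans 1≤k (ℕ.m≤n*m k 2)) ∘ double ∘ hasSquareFactor-sound)
  where
  halve : HasSquareFactor (2 * k) → HasSquareFactor k
  halve (d , 2≤d , dd∣2k) = d , 2≤d , coprime-divisor (odd⇒coprime-2 (odd*odd odd-d odd-d)) dd∣2k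
    where
    odd-d : Odd d
    odd-d 2∣d = odd-k (*-cancelˡ-∣ 2 (∣-trans (*-pres-∣ 2∣d 2∣d) dd∣2k))
  double : HasSquareFactor k → HasSquareFactor (2 * k)
  double (d , 2≤d , dd∣k) = d , 2≤d , ∣n⇒∣m*n 2 dd∣k

μ-4∣ : ∀ {n} → 4 ∣ n → μ n ≡ + 0
μ-4∣ {zero}  _   = ≡.refl
μ-4∣ {suc n} 4∣n with hasSquareFactor (suc n) | hasSquareFactor-complete (s≤s z≤n) (2 , s≤s (s≤s z≤n) , 4∣n)
... | true | _ = ≡.refl

primeDivisor? : ∀ n → Decidable (λ p → Prime p × p ∣ n)
primeDivisor? n p = prime? p ×-dec p ∣? n

ω≡count : ∀ n → ω n ≡ count (primeDivisor? n) n
ω≡count n = length-filter-range1 (primeDivisor? n) n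

ω-2*odd : ∀ {k} → 1 ≤ k → Odd k → ω (2 * k) ≡ suc (ω k)
ω-2*odd {k} 1≤k odd-k = begin
  ω (2 * k)
    ≡⟨ ω≡count (2 * k) ⟩
  count (primeDivisor? (2 * k)) (2 * k)
    ≡⟨ ∑-cong (2 * k) (λ p _ _ →
        indicator-⊎ (primeDivisor? (2 * k) p) (primeDivisor? k p) (p ℕ.≟ 2) (split p) (λ (pr , p∣k) → pr , ∣n⇒∣m*n 2 p∣k)
        (λ { ≡.refl → prime[2] , m∣m*n k }) (λ { (_ , p∣k) ≡.refl → odd-k p∣k })) ⟩
  ∑ (λ p → indicator (primeDivisor? k p) + indicator (p ℕ.≟ 2)) (2 * k)
    ≡⟨ ∑-∙ _ _ (2 * k) ⟩
  count (primeDivisor? k) (2 * k) + count (ℕ._≟ 2) (2 * k)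
    ≡⟨ cong₂ _+_ no-large-divisors count-≡2 ⟩
  count (primeDivisor? k) k + 1
    ≡⟨ ℕ.+-comm _ 1 ⟩
  suc (count (primeDivisor? k) k)
    ≡⟨ cong suc (ω≡count k) ⟨
  suc (ω k)
    ∎
  where
  open ≡.≡-Reasoning
  split : ∀ p → Prime p × p ∣ 2 * k → (Prime p × p ∣ k) ⊎ p ≡ 2
  split p (pr , p∣2k) with euclidsLemma 2 k pr p∣2k
  ... | inj₂ p∣k = inj₁ (pr , p∣k)
  ... | inj₁ p∣2 with irreducible[2] p∣2
  ...   | inj₁ ≡.refl = ⊥-elim (¬prime[1] pr)
  ...   | inj₂ p≡2    = inj₂ p≡2
  no-large-divisors : count (primeDivisor? k) (2 * k) ≡ count (primeDivisor? k) k
  no-large-divisors = ≡.trans (count-2* (primeDivisor? k) k) (≡.trans (cong (_+_ (count (primeDivisor? k) k))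
    (ℕΣ.∑-vanish k (λ x 1≤x _ → indicator-no (primeDivisor? k (k + x))
      (λ (_ , k+x∣k) → ℕ.<⇒≱ (ℕ.m<m+n k 1≤x) (∣⇒≤ {{ℕ.>-nonZero 1≤k}} k+x∣k)))))
    (ℕ.+-identityʳ _))
  count-≡2 : count (ℕ._≟ 2) (2 * k) ≡ 1
  count-≡2 = ≡.trans (∑-split _ (ℕ.*-monoʳ-≤ 2 1≤k))
    (cong suc (ℕΣ.∑-vanish (2 * k ∸ 2) (λ x 1≤x _ → indicator-no ((2 + x) ℕ.≟ 2) (ℕ.<⇒≢ (ℕ.m<m+n 2 1≤x) ∘ ≡.sym))))

μ-2*odd : ∀ {k} → 1 ≤ k → Odd k → μ (2 * k) ≡ ℤ.- μ k
μ-2*odd {suc k} 1≤k odd-k = begin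
  μ (2 * suc k)
    ≡⟨ cong₂ (λ b w → if b then + 0 else ℤ.-1ℤ ℤ.^ w)
        (hasSquareFactor-2*odd 1≤k odd-k) (ω-2*odd 1≤k odd-k) ⟩
  (if hasSquareFactor (suc k) then + 0 else ℤ.-1ℤ ℤ.^ suc (ω (suc k)))
    ≡⟨ flip-sign (hasSquareFactor (suc k)) ⟩
  ℤ.- (if hasSquareFactor (suc k) then + 0 else ℤ.-1ℤ ℤ.^ ω (suc k))
    ∎
  where
  open ≡.≡-Reasoning
  flip-sign : ∀ b → (if b then + 0 else ℤ.-1ℤ ℤ.^ suc (ω (suc k))) ≡ ℤ.- (if b then + 0 else ℤ.-1ℤ ℤ.^ ω (suc k))
  flip-sign true  = ≡.refl
  flip-sign false = ℤ.-1*i≡-i _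

∣μ∣≤1 : ∀ n → ℤ.∣ μ n ∣ ≤ 1
∣μ∣≤1 zero    = z≤n
∣μ∣≤1 (suc n) with hasSquareFactor (suc n)
... | true  = z≤n
... | false = ℕ.≤-reflexive (∣-1^∣≡1 (ω (suc n)))
  where
  ∣-1^∣≡1 : ∀ w → ℤ.∣ ℤ.-1ℤ ℤ.^ w ∣ ≡ 1
  ∣-1^∣≡1 zero    = ≡.refl
  ∣-1^∣≡1 (suc w) = ≡.trans (ℤ.abs-* ℤ.-1ℤ (ℤ.-1ℤ ℤ.^ w)) (≡.trans (ℕ.*-identityˡ _) (∣-1^∣≡1 w))

-- Rational estimates

toℚᵘ-/ : ∀ i n → toℚᵘ (i / suc n) ℚᵘ.≃ mkℚᵘ i n
toℚᵘ-/ i n = ℚ.toℚᵘ-fromℚᵘ (mkℚᵘ i n)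

frac-* : ∀ (c x : ℤ) q d .{{_ : NonZero q}} → frac (c ℤ.* x) (q ℕ.* d) ≡ (c / q) ℚ.* frac x d
frac-* c x q       zero    rewrite ℕ.*-zeroʳ q = ≡.sym (ℚ.*-zeroʳ (c / q))
frac-* c x (suc q) (suc d) = ℚ.toℚᵘ-injective (ℚᵘ.≃-trans (toℚᵘ-/ (c ℤ.* x) _)
  (ℚᵘ.≃-sym (ℚᵘ.≃-trans (ℚ.toℚᵘ-homo-* (c / suc q) (x / suc d)) (ℚᵘ.*-cong (toℚᵘ-/ c q) (toℚᵘ-/ x d)))))

frac-0 : ∀ d → frac (+ 0) d ≡ 0ℚ
frac-0 zero    = ≡.refl
frac-0 (suc d) = ℚ.0/n≡0 (suc d)

/-mono-≤ : ∀ a l b m → a ℕ.* suc m ≤ b ℕ.* suc l → (+ a) / suc l ℚ.≤ (+ b) / suc m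
/-mono-≤ a l b m a*m≤b*l = ℚ.toℚᵘ-cancel-≤
  (ℚᵘ.≤-respˡ-≃ (ℚᵘ.≃-sym (toℚᵘ-/ (+ a) l)) (ℚᵘ.≤-respʳ-≃ (ℚᵘ.≃-sym (toℚᵘ-/ (+ b) m)) (*≤* cross)))
  where
  cross : (+ a) ℤ.* (+ suc m) ℤ.≤ (+ b) ℤ.* (+ suc l)
  cross rewrite ≡.sym (ℤ.pos-* a (suc m)) | ≡.sym (ℤ.pos-* b (suc l)) = ℤ.+≤+ a*m≤b*l

∣frac∣≤ : ∀ (x : ℤ) d b l → ℤ.∣ x ∣ ≤ b → suc l ≤ d → ℚ.∣ frac x d ∣ ℚ.≤ (+ b) / suc l
∣frac∣≤ x (suc d) b l ∣x∣≤b l<d = ℚ.toℚᵘ-cancel-≤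
  (ℚᵘ.≤-respˡ-≃ (ℚᵘ.≃-sym (ℚᵘ.≃-trans (ℚ.toℚᵘ-homo-∣-∣ (x / suc d)) (ℚᵘ.∣-∣-cong (toℚᵘ-/ x d))))
  (ℚᵘ.≤-respʳ-≃ (ℚᵘ.≃-sym (toℚᵘ-/ (+ b) l)) (*≤* cross)))
  where
  cross : (+ ℤ.∣ x ∣) ℤ.* (+ suc l) ℤ.≤ (+ b) ℤ.* (+ suc d)
  cross rewrite ≡.sym (ℤ.pos-* ℤ.∣ x ∣ (suc l)) | ≡.sym (ℤ.pos-* b (suc d)) = ℤ.+≤+ (ℕ.*-mono-≤ ∣x∣≤b l<d)

/-+ : ∀ a b l → (+ a) / suc l ℚ.+ (+ b) / suc l ≡ (+ (a ℕ.+ b)) / suc l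
/-+ a b l = ℚ.toℚᵘ-injective (ℚᵘ.≃-trans (ℚ.toℚᵘ-homo-+ ((+ a) / suc l) ((+ b) / suc l))
  (ℚᵘ.≃-trans (ℚᵘ.+-cong (toℚᵘ-/ (+ a) l) (toℚᵘ-/ (+ b) l)) (ℚᵘ.≃-sym (ℚᵘ.≃-trans (toℚᵘ-/ (+ (a ℕ.+ b)) l) (*≡* cross)))))
  where
  open ℤ-Solver
  cross : + (a ℕ.+ b) ℤ.* (+ (suc l ℕ.* suc l)) ≡ ((+ a) ℤ.* (+ suc l) ℤ.+ (+ b) ℤ.* (+ suc l)) ℤ.* (+ suc l)
  cross rewrite ℤ.pos-+ a b | ℤ.pos-* (suc l) (suc l) =
    solve 3 (λ A B L → (A :+ B) :* (L :* L) := (A :* L :+ B :* L) :* L) ≡.refl (+ a) (+ b) (+ suc l)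

∑-const-/ : ∀ a l n → ℚΣ.∑ (λ _ → (+ a) / suc l) n ≡ (+ (n ℕ.* a)) / suc l
∑-const-/ a l zero    = ≡.sym (frac-0 (suc l))
∑-const-/ a l (suc n) = ≡.trans (cong (ℚ._+ (+ a) / suc l) (∑-const-/ a l n))
  (≡.trans (/-+ (n ℕ.* a) a l) (cong (λ k → (+ k) / suc l) (ℕ.+-comm (n ℕ.* a) a)))

∣∑∣≤∑ : ∀ (f g : ℕ → ℚ) n → (∀ x → 1 ≤ x → x ≤ n → ℚ.∣ f x ∣ ℚ.≤ g x) → ℚ.∣ ℚΣ.∑ f n ∣ ℚ.≤ ℚΣ.∑ g n
∣∑∣≤∑ f g zero    _      = ℚ.≤-refl
∣∑∣≤∑ f g (suc n) ∣f∣≤g = ℚ.≤-trans (ℚ.∣p+q∣≤∣p∣+∣q∣ (ℚΣ.∑ f n) (f (suc n)))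
  (ℚ.+-mono-≤ (∣∑∣≤∑ f g n (λ x 1≤x x≤n → ∣f∣≤g x 1≤x (ℕ.m≤n⇒m≤1+n x≤n))) (∣f∣≤g (suc n) (s≤s z≤n) ℕ.≤-refl))

archimedean : ∀ a (ε : ℚ) → 0ℚ ℚ.< ε → Σ ℕ λ l → (+ a) / suc l ℚ.< ε
archimedean a (ℚ.mkℚ +[1+ p ] q _) (ℚ.*<* _) = l , ℚ.toℚᵘ-cancel-< (ℚᵘ.<-respˡ-≃ (ℚᵘ.≃-sym (toℚᵘ-/ (+ a) l)) (*<* cross))
  where
  l = a ℕ.* suc q
  cross : (+ a) ℤ.* (+ suc q) ℤ.< (+ suc p) ℤ.* (+ suc l)
  cross rewrite ≡.sym (ℤ.pos-* a (suc q)) | ≡.sym (ℤ.pos-* (suc p) (suc l)) = ℤ.+<+ (s≤s (ℕ.m≤m+n l (p ℕ.* suc l)))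
archimedean a (ℚ.mkℚ (+ 0)    q _) (ℚ.*<* (ℤ.+<+ ()))
archimedean a (ℚ.mkℚ -[1+ p ] q _) (ℚ.*<* ())

-- The series S(h, t, m)

module _ {h t : ℕ} (1≤h : 1 ≤ h) (1≤t : 1 ≤ t) where

  summand : ℕ → ℚ
  summand n = frac (μ n ℤ.* + gcd (n * t) h) (n * t * φ (n * t))

  oddSummand evenSummand : ℕ → ℚ
  oddSummand  n = if does (2 ∣? n) then 0ℚ else summand n
  evenSummand n = if does (2 ∣? n) then summand n else 0ℚ

  oddSum evenSum : ℕ → ℚ
  oddSum  = ℚΣ.∑ oddSummand
  evenSum = ℚΣ.∑ evenSummand

  Spart-1≡ : ∀ N → Spart h t 1 N ≡ oddSum N ℚ.+ evenSum N
  Spart-1≡ N = begin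
    Spart h t 1 N                       ≡⟨ ℚΣ.foldr-range1 (term h t 1) N ⟩
    ℚΣ.∑ (term h t 1) N                 ≡⟨ ℚΣ.∑-cong N (λ n _ _ → ≡.trans (term-1 n) (split n)) ⟩
    ℚΣ.∑ (λ n → oddSummand n ℚ.+ evenSummand n) N ≡⟨ ℚΣ.∑-∙ oddSummand evenSummand N ⟩
    oddSum N ℚ.+ evenSum N              ∎
    where
    open ≡.≡-Reasoning
    term-1 : ∀ n → term h t 1 n ≡ summand n
    term-1 n = cong (λ b → if b then summand n else 0ℚ) (dec-true (1 ∣? (n * t)) (1∣ (n * t)))
    split : ∀ n → summand n ≡ oddSummand n ℚ.+ evenSummand n
    split n with does (2 ∣? n)
    ... | true  = ≡.sym (ℚ.+-identityˡ (summand n))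
    ... | false = ≡.sym (ℚ.+-identityʳ (summand n))

  Spart-2t₂≡ : ∀ N → Spart h t (2 * t ₂) N ≡ evenSum N
  Spart-2t₂≡ N = ≡.trans (ℚΣ.foldr-range1 (term h t (2 * t ₂)) N) (ℚΣ.∑-cong N (λ n _ _ → term-2t₂ n))
    where
    term-2t₂ : ∀ n → term h t (2 * t ₂) n ≡ evenSummand n
    term-2t₂ n = cong (λ b → if b then summand n else 0ℚ) (does-cong (2 * t ₂ ∣? n * t) (2 ∣? n)
      (λ 2t₂∣nt → decidable-stable (2 ∣? n) (λ odd-n → ₂*2∤odd* 1≤t odd-n (subst (_∣ n * t) (ℕ.*-comm 2 (t ₂)) 2t₂∣nt)))
      (λ 2∣n → *-pres-∣ 2∣n (₂∣ 1≤t)))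

  DoublingRatio : ℚ → Set
  DoublingRatio a = ∀ k → 1 ≤ k → Odd k → summand (2 * k) ≡ a ℚ.* summand k

  doublingRatio : ∀ r s → (∀ {k} → Odd k → gcd (2 * (k * t)) h ≡ r * gcd (k * t) h) →
                  (∀ {k} → Odd k → φ (2 * (k * t)) ≡ suc s * φ (k * t)) → DoublingRatio ((ℤ.- + r) / (2 * suc s))
  doublingRatio r s gcd-2kt φ-2kt k 1≤k odd-k = begin
    summand (2 * k)
      ≡⟨ cong (λ y → frac (μ (2 * k) ℤ.* + gcd y h) (y * φ y)) (ℕ.*-assoc 2 k t) ⟩
    frac (μ (2 * k) ℤ.* + gcd (2 * x) h) (2 * x * φ (2 * x))
      ≡⟨ cong₂ (λ m g → frac (m ℤ.* + g) (2 * x * φ (2 * x))) (μ-2*odd 1≤k odd-k) (gcd-2kt odd-k) ⟩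
    frac (ℤ.- μ k ℤ.* + (r * gcd x h)) (2 * x * φ (2 * x))
      ≡⟨ cong₂ frac numerator denominator ⟩
    frac ((ℤ.- + r) ℤ.* (μ k ℤ.* + gcd x h)) (2 * suc s * (x * φ x))
      ≡⟨ frac-* (ℤ.- + r) (μ k ℤ.* + gcd x h) (2 * suc s) (x * φ x) ⟩
    (ℤ.- + r) / (2 * suc s) ℚ.* summand k
      ∎
    where
    open ≡.≡-Reasoning
    x = k * t
    numerator : ℤ.- μ k ℤ.* + (r * gcd x h) ≡ (ℤ.- + r) ℤ.* (μ k ℤ.* + gcd x h)
    numerator = ≡.trans (cong (ℤ.- μ k ℤ.*_) (ℤ.pos-* r (gcd x h)))
      (solve 3 (λ m R g → (:- m) :* (R :* g) := (:- R) :* (m :* g)) ≡.refl (μ k) (+ r) (+ gcd x h))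
      where open ℤ-Solver
    denominator : 2 * x * φ (2 * x) ≡ 2 * suc s * (x * φ x)
    denominator rewrite φ-2kt odd-k =
      solve 3 (λ X S F → con 2 :* X :* (S :* F) := con 2 :* S :* (X :* F)) ≡.refl x (suc s) (φ x)
      where open ℕ-Solver

  evenSummand-odd : ∀ m → evenSummand (suc (2 * m)) ≡ 0ℚ
  evenSummand-odd m = cong (λ b → if b then summand (suc (2 * m)) else 0ℚ) (dec-false (2 ∣? suc (2 * m)) (odd-1+2* m))

  module _ {a : ℚ} (ratio : DoublingRatio a) where

    evenSummand-2* : ∀ k → 1 ≤ k → evenSummand (2 * k) ≡ a ℚ.* oddSummand k
    evenSummand-2* k 1≤k with 2 ∣? k
    ... | yes 2∣k = begin
      evenSummand (2 * k)
        ≡⟨ cong (λ b → if b then summand (2 * k) else 0ℚ) (dec-true (2 ∣? 2 * k) (m∣m*n k)) ⟩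
      summand (2 * k)
        ≡⟨ cong (λ m → frac (m ℤ.* + gcd (2 * k * t) h) (2 * k * t * φ (2 * k * t))) (μ-4∣ (*-monoʳ-∣ 2 2∣k)) ⟩
      frac (+ 0) (2 * k * t * φ (2 * k * t))
        ≡⟨ frac-0 (2 * k * t * φ (2 * k * t)) ⟩
      0ℚ
        ≡⟨ ℚ.*-zeroʳ a ⟨
      a ℚ.* 0ℚ
        ≡⟨ cong (λ b → a ℚ.* (if b then 0ℚ else summand k)) (dec-true (2 ∣? k) 2∣k) ⟨
      a ℚ.* oddSummand k
        ∎
      where open ≡.≡-Reasoning
    ... | no odd-k = begin
      evenSummand (2 * k)
        ≡⟨ cong (λ b → if b then summand (2 * k) else 0ℚ) (dec-true (2 ∣? 2 * k) (m∣m*n k)) ⟩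
      summand (2 * k)
        ≡⟨ ratio k 1≤k odd-k ⟩
      a ℚ.* summand k
        ≡⟨ cong (λ b → a ℚ.* (if b then 0ℚ else summand k)) (dec-false (2 ∣? k) odd-k) ⟨
      a ℚ.* oddSummand k
        ∎
      where open ≡.≡-Reasoning

    evenSum-2* : ∀ m → evenSum (2 * m) ≡ a ℚ.* oddSum m
    evenSum-2* zero    = ≡.sym (ℚ.*-zeroʳ a)
    evenSum-2* (suc m) = begin
      evenSum (2 * suc m)
        ≡⟨ cong evenSum (ℕ.*-suc 2 m) ⟩
      evenSum (2 * m) ℚ.+ evenSummand (suc (2 * m)) ℚ.+ evenSummand (2 + 2 * m)
        ≡⟨ cong₂ (λ e o → e ℚ.+ o ℚ.+ evenSummand (2 + 2 * m)) (evenSum-2* m) (evenSummand-odd m) ⟩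
      a ℚ.* oddSum m ℚ.+ 0ℚ ℚ.+ evenSummand (2 + 2 * m)
        ≡⟨ cong₂ ℚ._+_ (ℚ.+-identityʳ (a ℚ.* oddSum m))
            (≡.trans (cong evenSummand (≡.sym (ℕ.*-suc 2 m))) (evenSummand-2* (suc m) (s≤s z≤n))) ⟩
      a ℚ.* oddSum m ℚ.+ a ℚ.* oddSummand (suc m)
        ≡⟨ ℚ.*-distribˡ-+ a (oddSum m) (oddSummand (suc m)) ⟨
      a ℚ.* oddSum (suc m)
        ∎
      where open ≡.≡-Reasoning

    evenSum≡ : ∀ N → evenSum N ≡ a ℚ.* oddSum ⌊ N /2⌋
    evenSum≡ N with parity N
    ... | inj₁ N≡2m   = ≡.trans (cong evenSum N≡2m) (evenSum-2* ⌊ N /2⌋)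
    ... | inj₂ N≡1+2m = begin
      evenSum N
        ≡⟨ cong evenSum N≡1+2m ⟩
      evenSum (2 * ⌊ N /2⌋) ℚ.+ evenSummand (suc (2 * ⌊ N /2⌋))
        ≡⟨ cong (ℚ._+_ (evenSum (2 * ⌊ N /2⌋))) (evenSummand-odd ⌊ N /2⌋) ⟩
      evenSum (2 * ⌊ N /2⌋) ℚ.+ 0ℚ
        ≡⟨ ℚ.+-identityʳ (evenSum (2 * ⌊ N /2⌋)) ⟩
      evenSum (2 * ⌊ N /2⌋)
        ≡⟨ evenSum-2* ⌊ N /2⌋ ⟩
      a ℚ.* oddSum ⌊ N /2⌋
        ∎
      where open ≡.≡-Reasoning

  φ-*t-≥ : ∀ {n} j → Odd n → 2 ^ suc j ≤ n → j ≤ φ (n * t)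
  φ-*t-≥ {n} j odd-n 2^j+1≤n =
    subst (j ≤_) (cong φ nt≡) (φ-2^*odd-≥ exponent (odd*odd odd-n odd-cofactor) j (ℕ.≤-trans 2^j+1≤n n≤nc))
    where
    open IsTwoPart (₂-isTwoPart 1≤t)
    n≤nc : n ≤ n * cofactor
    n≤nc = ℕ.m≤m*n n cofactor {{ℕ.>-nonZero (odd⇒≥1 odd-cofactor)}}
    nt≡ : 2 ^ exponent * (n * cofactor) ≡ n * t
    nt≡ = begin
      2 ^ exponent * (n * cofactor) ≡⟨ ℕ.*-assoc (2 ^ exponent) n cofactor ⟨
      2 ^ exponent * n * cofactor   ≡⟨ cong (_* cofactor) (ℕ.*-comm (2 ^ exponent) n) ⟩
      n * 2 ^ exponent * cofactor   ≡⟨ ℕ.*-assoc n (2 ^ exponent) cofactor ⟩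
      n * (2 ^ exponent * cofactor) ≡⟨ cong (n *_) a≡2^e*c ⟨
      n * t                         ∎
      where open ≡.≡-Reasoning

  ∣oddSummand∣≤ : ∀ m b n → suc m ≤ n → 2 ^ suc (suc b) ≤ n → ℚ.∣ oddSummand n ∣ ℚ.≤ (+ h) / (suc m * suc b)
  ∣oddSummand∣≤ m b n m<n 2^b+2≤n = bound (2 ∣? n)
    where
    bound : Dec (2 ∣ n) → ℚ.∣ oddSummand n ∣ ℚ.≤ (+ h) / (suc m * suc b)
    bound (yes 2∣n) rewrite dec-true (2 ∣? n) 2∣n = /-mono-≤ 0 0 h (b + m * suc b) z≤n
    bound (no odd-n) rewrite dec-false (2 ∣? n) odd-n =
      ∣frac∣≤ (μ n ℤ.* + gcd (n * t) h) (n * t * φ (n * t)) h (b + m * suc b) numerator≤ denominator≥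
      where
      numerator≤ : ℤ.∣ μ n ℤ.* + gcd (n * t) h ∣ ≤ h
      numerator≤ = subst (_≤ h) (≡.sym (ℤ.abs-* (μ n) (+ gcd (n * t) h)))
        (subst (ℤ.∣ μ n ∣ * gcd (n * t) h ≤_) (ℕ.*-identityˡ h)
          (ℕ.*-mono-≤ (∣μ∣≤1 n) (gcd[m,n]≤n (n * t) h {{ℕ.>-nonZero 1≤h}})))
      denominator≥ : suc m * suc b ≤ n * t * φ (n * t)
      denominator≥ = ℕ.*-mono-≤ (ℕ.≤-trans m<n (ℕ.m≤m*n n t {{ℕ.>-nonZero 1≤t}})) (φ-*t-≥ (suc b) odd-n 2^b+2≤n)

  oddSum-tail : ∀ ε → 0ℚ ℚ.< ε → Σ ℕ λ N₀ → ∀ N → N₀ ≤ N → ℚ.∣ oddSum N ℚ.- oddSum ⌊ N /2⌋ ∣ ℚ.< ε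
  oddSum-tail ε ε>0 with archimedean h ε ε>0
  ... | b , h/b<ε = P + P , bound
    where
    P = 2 ^ suc (suc b)
    bound : ∀ N → P + P ≤ N → ℚ.∣ oddSum N ℚ.- oddSum ⌊ N /2⌋ ∣ ℚ.< ε
    bound N 2P≤N = begin-strict
      ℚ.∣ oddSum N ℚ.- oddSum M ∣
        ≡⟨ cong ℚ.∣_∣ tail≡ ⟩
      ℚ.∣ ℚΣ.∑ (λ x → oddSummand (M + x)) K ∣
        ≤⟨ ∣∑∣≤∑ _ (λ _ → (+ h) / (suc M * suc b)) K (λ x 1≤x _ →
            ∣oddSummand∣≤ M b (M + x) (ℕ.≤-trans (ℕ.≤-reflexive (ℕ.+-comm 1 M)) (ℕ.+-monoʳ-≤ M 1≤x))
            (ℕ.≤-trans P≤M (ℕ.m≤m+n M x))) ⟩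
      ℚΣ.∑ (λ _ → (+ h) / (suc M * suc b)) K
        ≡⟨ ∑-const-/ h (b + M * suc b) K ⟩
      (+ (K * h)) / (suc M * suc b)
        ≤⟨ /-mono-≤ (K * h) (b + M * suc b) h b K*h*b≤h*M*b ⟩
      (+ h) / suc b
        <⟨ h/b<ε ⟩
      ε
        ∎
      where
      open ℚ.≤-Reasoning
      M = ⌊ N /2⌋
      K = ⌈ N /2⌉
      P≤M : P ≤ M
      P≤M = subst (_≤ M) (≡.sym (ℕ.n≡⌊n+n/2⌋ P)) (ℕ.⌊n/2⌋-mono 2P≤N)
      tail≡ : oddSum N ℚ.- oddSum M ≡ ℚΣ.∑ (λ x → oddSummand (M + x)) K
      tail≡ = ≡.trans (cong (λ n → oddSum n ℚ.- oddSum M) (≡.sym (ℕ.⌊n/2⌋+⌈n/2⌉≡n N)))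
        (≡.trans (cong (ℚ._- oddSum M) (ℚΣ.∑-+ oddSummand M K))
          (solve 2 (λ p q → p :+ q :- p := q) ≡.refl (oddSum M) (ℚΣ.∑ (λ x → oddSummand (M + x)) K)))
        where open ℚ-Solver
      K*h*b≤h*M*b : K * h * suc b ≤ h * (suc M * suc b)
      K*h*b≤h*M*b = ℕ.≤-trans (ℕ.*-monoˡ-≤ (suc b) (ℕ.*-monoˡ-≤ h (⌈n/2⌉≤1+⌊n/2⌋ N)))
        (ℕ.≤-reflexive (solve 3 (λ m H b → m :* H :* b := H :* (m :* b)) ≡.refl (suc M) h (suc b)))
        where open ℕ-Solver

  Spart-2t₂-≈lim : ∀ a c → DoublingRatio a → ℚ.∣ c ∣ ℚ.≤ 1ℚ → a ℚ.+ a ℚ.* c ≡ - c →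
                   Spart h t (2 * t ₂) ≈lim (λ N → - (c ℚ.* Spart h t 1 N))
  Spart-2t₂-≈lim a c ratio ∣c∣≤1 a+ac≡-c ε ε>0 = proj₁ tail , λ N N₀≤N → begin-strict
    ℚ.∣ Spart h t (2 * t ₂) N ℚ.- - (c ℚ.* Spart h t 1 N) ∣
      ≡⟨ cong ℚ.∣_∣ (gap N) ⟩
    ℚ.∣ c ℚ.* D N ∣
      ≡⟨ ℚ.∣p*q∣≡∣p∣*∣q∣ c (D N) ⟩
    ℚ.∣ c ∣ ℚ.* ℚ.∣ D N ∣
      ≤⟨ ℚ.*-monoʳ-≤-nonNeg ℚ.∣ D N ∣ {{ℚ.∣-∣-nonNeg (D N)}} ∣c∣≤1 ⟩
    1ℚ ℚ.* ℚ.∣ D N ∣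
      ≡⟨ ℚ.*-identityˡ ℚ.∣ D N ∣ ⟩
    ℚ.∣ D N ∣
      <⟨ proj₂ tail N N₀≤N ⟩
    ε
      ∎
    where
    open ℚ.≤-Reasoning
    tail = oddSum-tail ε ε>0
    D : ℕ → ℚ
    D N = oddSum N ℚ.- oddSum ⌊ N /2⌋
    gap : ∀ N → Spart h t (2 * t ₂) N ℚ.- - (c ℚ.* Spart h t 1 N) ≡ c ℚ.* D N
    gap N = begin-equality
      Spart h t (2 * t ₂) N ℚ.- - (c ℚ.* Spart h t 1 N)
        ≡⟨ cong₂ (λ e s → e ℚ.- - (c ℚ.* s)) (Spart-2t₂≡ N) (Spart-1≡ N) ⟩
      E ℚ.- - (c ℚ.* (O ℚ.+ E))
        ≡⟨ cong (λ e → e ℚ.- - (c ℚ.* (O ℚ.+ e))) (evenSum≡ {a} ratio N) ⟩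
      a ℚ.* O′ ℚ.- - (c ℚ.* (O ℚ.+ a ℚ.* O′))
        ≡⟨ solve 4 (λ a c o o′ → a :* o′ :- (:- (c :* (o :+ a :* o′))) := c :* o :+ (a :+ a :* c) :* o′) ≡.refl a c O O′ ⟩
      c ℚ.* O ℚ.+ (a ℚ.+ a ℚ.* c) ℚ.* O′
        ≡⟨ cong (λ x → c ℚ.* O ℚ.+ x ℚ.* O′) a+ac≡-c ⟩
      c ℚ.* O ℚ.+ - c ℚ.* O′
        ≡⟨ solve 3 (λ c o o′ → c :* o :+ (:- c) :* o′ := c :* (o :- o′)) ≡.refl c O O′ ⟩
      c ℚ.* D N
        ∎
      where
      open ℚ-Solver
      O = oddSum N
      O′ = oddSum ⌊ N /2⌋
      E = evenSum N

  doublingRatio-lcm∣ : lcm 2 (h ₂) ∣ t ₂ → DoublingRatio (ℤ.-1ℤ / 4)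
  doublingRatio-lcm∣ lcm∣t₂ = doublingRatio 1 1
    (λ {k} _ → ≡.trans (gcd-2*-≡ (h ₂) 1≤h (∣n⇒∣m*n k h₂∣t) (₂∣ 1≤h) h₂*2∤h) (≡.sym (ℕ.*-identityˡ _)))
    (λ {k} _ → φ-2*-even (∣n⇒∣m*n k 2∣t))
    where
    2∣t : 2 ∣ t
    2∣t = ∣-trans (∣-trans (m∣lcm[m,n] 2 (h ₂)) lcm∣t₂) (₂∣ 1≤t)
    h₂∣t : h ₂ ∣ t
    h₂∣t = ∣-trans (∣-trans (n∣lcm[m,n] 2 (h ₂)) lcm∣t₂) (₂∣ 1≤t)
    h₂*2∤h : ¬ (h ₂ * 2 ∣ h)
    h₂*2∤h = ₂*2∤odd* 1≤h odd-1 ∘ subst (h ₂ * 2 ∣_) (≡.sym (ℕ.*-identityˡ h))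

  doublingRatio-odd : Odd h → Odd t → DoublingRatio (ℤ.-1ℤ / 2)
  doublingRatio-odd odd-h odd-t = doublingRatio 1 0
    (λ {k} _ → ≡.trans (gcd-2*-≡ 1 1≤h (1∣ (k * t)) (1∣ h) odd-h) (≡.sym (ℕ.*-identityˡ _)))
    (λ {k} odd-k → ≡.trans (φ-2*-odd (odd*odd odd-k odd-t)) (≡.sym (ℕ.*-identityˡ _)))

  doublingRatio-even : 2 ∣ t → ¬ (lcm 2 (h ₂) ∣ t ₂) → DoublingRatio (ℤ.-1ℤ / 2)
  doublingRatio-even 2∣t lcm∤t₂ = doublingRatio 2 1
    (λ {k} odd-k → gcd-2*-double (t ₂) 1≤h (∣n⇒∣m*n k (₂∣ 1≤t)) t₂*2∣h (₂*2∤odd* 1≤t odd-k))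
    (λ {k} _ → φ-2*-even (∣n⇒∣m*n k 2∣t))
    where
    t₂*2∣h : t ₂ * 2 ∣ h
    t₂*2∣h = ∣-trans (₂∤⇒₂*2∣ 1≤h 1≤t (λ h₂∣t₂ → lcm∤t₂ (lcm-least (2∣⇒2∣₂ 1≤t 2∣t) h₂∣t₂))) (₂∣ 1≤h)

≈lim-congʳ : ∀ {f g g′ : ℕ → ℚ} → (∀ N → g N ≡ g′ N) → f ≈lim g → f ≈lim g′
≈lim-congʳ {f} g≡g′ f≈g ε ε>0 = proj₁ (f≈g ε ε>0) , λ N N₀≤N →
  subst (λ y → ℚ.∣ f N ℚ.- y ∣ ℚ.< ε) (g≡g′ N) (proj₂ (f≈g ε ε>0) N N₀≤N)

lemma3 : (h t : ℕ) → 1 ≤ h → 1 ≤ t → ¬ ((2 ∣ h) × ¬ (2 ∣ t)) →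
    (lcm 2 (h ₂) ∣ t ₂ →
      Spart h t (2 * t ₂) ≈lim (λ N → - ((+ 1 / 3) *ℚ Spart h t 1 N))) ×
    (¬ (lcm 2 (h ₂) ∣ t ₂) →
      Spart h t (2 * t ₂) ≈lim (λ N → - Spart h t 1 N))
lemma3 h t 1≤h 1≤t ¬[2∣h×odd-t] = lcm∣-case , lcm∤-case
  where
  lcm∣-case : lcm 2 (h ₂) ∣ t ₂ → Spart h t (2 * t ₂) ≈lim (λ N → - ((+ 1 / 3) *ℚ Spart h t 1 N))
  lcm∣-case lcm∣t₂ = Spart-2t₂-≈lim 1≤h 1≤t (ℤ.-1ℤ / 4) (+ 1 / 3) (doublingRatio-lcm∣ 1≤h 1≤t lcm∣t₂)
                                    (ℚ.*≤* (ℤ.+≤+ (s≤s z≤n))) ≡.refl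
  lcm∤-case : ¬ (lcm 2 (h ₂) ∣ t ₂) → Spart h t (2 * t ₂) ≈lim (λ N → - Spart h t 1 N)
  lcm∤-case lcm∤t₂ = ≈lim-congʳ {Spart h t (2 * t ₂)} (λ N → cong -_ (ℚ.*-identityˡ (Spart h t 1 N)))
                       (Spart-2t₂-≈lim 1≤h 1≤t (ℤ.-1ℤ / 2) 1ℚ ratio ℚ.≤-refl ≡.refl)
    where
    ratio : DoublingRatio 1≤h 1≤t (ℤ.-1ℤ / 2)
    ratio with 2 ∣? t
    ... | yes 2∣t  = doublingRatio-even 1≤h 1≤t 2∣t lcm∤t₂
    ... | no odd-t = doublingRatio-odd 1≤h 1≤t (λ 2∣h → ¬[2∣h×odd-t] (2∣h , odd-t)) odd-t
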